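{- Let $\sigma$ be a 2-structure and let $X\subsetneq V(\sigma)$ be such that $\sigma[X]$ is prime. (1) If $M$ is a module of $\sigma$ with $X\subseteq M$, then every element of $V(\sigma)\setminus M$ is an isolated vertex of $\Gamma_{(\sigma,\overline{X})}$. (2) Given $\alpha\in X$, if $M$ is a module of $\sigma$ with $M\cap X=\{\alpha\}$, then every element of $M\setminus\{\alpha\}$ is an isolated vertex of $\Gamma_{(\sigma,\overline{X})}$.
   Context: A 2-structure $\sigma$ consists of a vertex set $V(\sigma)$ and an equivalence relation $\equiv_\sigma$ on the set of ordered pairs $(u,v)$ of distinct elements of $V(\sigma)$. For $W\subseteq V(\sigma)$, $\sigma[W]$ is the 2-structure on $W$ with the restricted equivalence relation. $\overline{X}=V(\sigma)\setminus X$. A subset $M\subseteq V(\sigma)$ is a module of $\sigma$ if for all $x,y\in M$ and $v\in V(\sigma)\setminus M$, $(x,v)\equiv_\sigma(y,v)$ and $(v,x)\equiv_\sigma(v,y)$; $\emptyset$, $V(\sigma)$ and singletons are trivial modules. $\sigma$ is prime if $|V(\sigma)|\geq 3$ and all its modules are trivial. For $X\subsetneq V(\sigma)$ with $\sigma[X]$ prime, the outside graph $\Gamma_{(\sigma,\overline{X})}$ is the graph with vertex set $\overline{X}$ whose edges are the 2-element subsets $Y\subseteq\overline{X}$ such that $\sigma[X\cup Y]$ is prime. -}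

module Defs where

open import Level using (0ℓ)
open import Data.Product using (Σ; ∃; _×_; _,_)
open import Data.Sum using (_⊎_)
open import Relation.Nullary using (¬_)
open import Relation.Binary.Core using (Rel)
open import Relation.Binary.Structures using (IsEquivalence)
open import Relation.Binary.PropositionalEquality using (_≡_; _≢_)
open import Relation.Unary using (Pred; _⊆_)
open import Function.Bundles using (_⇔_)

-- The relation is given on all of V × V; only its restriction to pairs of
-- distinct vertices is ever used (every use below involves distinct vertices).
record TwoStructure : Set₁ where
  field
    V      : Set
    _≃_    : Rel (V × V) 0ℓ
    isEquiv : IsEquivalence _≃_

Subset : TwoStructure → Set₁
Subset σ = Pred (TwoStructure.V σ) 0ℓ

module _ (σ : TwoStructure) where
  open TwoStructure σ

  IsModuleIn : Pred V 0ℓ → Pred V 0ℓ → Set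
  IsModuleIn W M =
    M ⊆ W ×
    (∀ {x y v} → M x → M y → W v → ¬ M v →
       ((x , v) ≃ (y , v)) × ((v , x) ≃ (v , y)))

  IsModule : Pred V 0ℓ → Set
  IsModule M = IsModuleIn (λ _ → ⊤') M
    where open import Data.Unit using () renaming (⊤ to ⊤')

  IsTrivialIn : Pred V 0ℓ → Pred V 0ℓ → Set
  IsTrivialIn W M =
    (∀ x → ¬ M x) ⊎
    ((∀ x → W x → M x) ⊎
     (Σ V λ a → W a × (∀ x → M x ⇔ (x ≡ a))))

  IsPrimeOn : Pred V 0ℓ → Set₁
  IsPrimeOn W =
    (Σ V λ a → Σ V λ b → Σ V λ c →
       W a × W b × W c × a ≢ b × a ≢ c × b ≢ c) ×
    (∀ M → IsModuleIn W M → IsTrivialIn W M)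

  _∪₂_,_ : Pred V 0ℓ → V → V → Pred V 0ℓ
  (X ∪₂ u , w) x = X x ⊎ (x ≡ u ⊎ x ≡ w)

  -- edges of the outside graph Γ_(σ, X̄): {u,w} ⊆ X̄, u ≠ w, σ[X ∪ {u,w}] prime
  OutsideEdge : Pred V 0ℓ → V → V → Set₁
  OutsideEdge X u w = ¬ X u × ¬ X w × u ≢ w × IsPrimeOn (X ∪₂ u , w)

  IsolatedOutside : Pred V 0ℓ → V → Set₁
  IsolatedOutside X u = ¬ X u × (∀ w → ¬ OutsideEdge X u w)

-- A module M of σ meets every W ⊆ V(σ) in a module M ∩ W of σ[W]. Both kinds of
-- edge {v , w} would make σ[X ∪ {v , w}] prime, yet M ∩ (X ∪ {v , w}) is then a
-- proper module with two points: in (1) two points of X, with v outside M; in (2)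
-- α and v, with a point of X other than α outside M.
module Submission where

open import Defs
open import Data.Product using (Σ; _×_; _,_; proj₁; proj₂)
open import Data.Sum using (inj₁; inj₂)
open import Data.Unit using (tt)
open import Relation.Nullary using (¬_)
open import Relation.Binary.PropositionalEquality using (_≡_; _≢_; refl; sym; trans)
open import Relation.Unary using (_⊆_; _∩_)
open import Function.Bundles using (_⇔_; Equivalence)

module _ (σ : TwoStructure) where
  open TwoStructure σ

  module∩-isModuleIn : ∀ {M} (W : Subset σ) → IsModule σ M → IsModuleIn σ W (M ∩ W)
  module∩-isModuleIn W (_ , congruent) =
    proj₂ , λ (mx , _) (my , _) wv ¬mwv → congruent mx my tt (λ mv → ¬mwv (mv , wv))

  ¬isTrivialIn : ∀ {W N a b} → N a → N b → a ≢ b → ¬ (W ⊆ N) → ¬ IsTrivialIn σ W N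
  ¬isTrivialIn na nb a≢b W⊈N (inj₁ empty)             = empty _ na
  ¬isTrivialIn na nb a≢b W⊈N (inj₂ (inj₁ full))       = W⊈N (full _)
  ¬isTrivialIn na nb a≢b W⊈N (inj₂ (inj₂ (_ , _ , N≡c))) =
    a≢b (trans (Equivalence.to (N≡c _) na) (sym (Equivalence.to (N≡c _) nb)))

  module∩-twoPoints⇒¬isPrimeOn : ∀ {M W a b} → IsModule σ M →
    (M ∩ W) a → (M ∩ W) b → a ≢ b → ¬ (W ⊆ M) → ¬ IsPrimeOn σ W
  module∩-twoPoints⇒¬isPrimeOn {M} {W} isModule ma mb a≢b W⊈M (_ , allTrivial) =
    ¬isTrivialIn ma mb a≢b (λ W⊆M∩W → W⊈M (λ wx → proj₁ (W⊆M∩W wx)))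
      (allTrivial (M ∩ W) (module∩-isModuleIn W isModule))

  singleton∩-¬⊇ : ∀ {M X : Subset σ} {α a b} → (∀ x → (M x × X x) ⇔ (x ≡ α)) →
    X a → X b → a ≢ b → ¬ (X ⊆ M)
  singleton∩-¬⊇ M∩X≡α xa xb a≢b X⊆M =
    a≢b (trans (Equivalence.to (M∩X≡α _) (X⊆M xa , xa))
          (sym (Equivalence.to (M∩X≡α _) (X⊆M xb , xb))))

lemma2p3 : (σ : TwoStructure) (X : Subset σ) →
    (Σ (TwoStructure.V σ) λ v → ¬ X v) →
    IsPrimeOn σ X →
    ((M : Subset σ) → IsModule σ M → X ⊆ M →
       ∀ v → ¬ M v → IsolatedOutside σ X v)
    ×
    ((α : TwoStructure.V σ) → X α → (M : Subset σ) → IsModule σ M →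
       (∀ x → (M x × X x) ⇔ (x ≡ α)) →
       ∀ v → M v → v ≢ α → IsolatedOutside σ X v)
lemma2p3 σ X _ ((a , b , _ , xa , xb , _ , a≢b , _) , _) = outsideModule , insideModule
  where
  outsideModule : (M : Subset σ) → IsModule σ M → X ⊆ M →
    ∀ v → ¬ M v → IsolatedOutside σ X v
  outsideModule M isModule X⊆M v ¬mv =
    (λ xv → ¬mv (X⊆M xv)) ,
    λ w (_ , _ , _ , prime) →
      module∩-twoPoints⇒¬isPrimeOn σ isModule (X⊆M xa , inj₁ xa) (X⊆M xb , inj₁ xb) a≢b
        (λ W⊆M → ¬mv (W⊆M (inj₂ (inj₁ refl)))) prime

  insideModule : (α : TwoStructure.V σ) → X α → (M : Subset σ) → IsModule σ M →
    (∀ x → (M x × X x) ⇔ (x ≡ α)) →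
    ∀ v → M v → v ≢ α → IsolatedOutside σ X v
  insideModule α xα M isModule M∩X≡α v mv v≢α =
    (λ xv → v≢α (Equivalence.to (M∩X≡α v) (mv , xv))) ,
    λ w (_ , _ , _ , prime) →
      module∩-twoPoints⇒¬isPrimeOn σ isModule
        (proj₁ (Equivalence.from (M∩X≡α α) refl) , inj₁ xα) (mv , inj₂ (inj₁ refl))
        (λ α≡v → v≢α (sym α≡v))
        (λ W⊆M → singleton∩-¬⊇ σ M∩X≡α xa xb a≢b (λ xx → W⊆M (inj₁ xx))) prime
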